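{- Let $G$ be a Frobenius group acting naturally on a finite set $\Omega$, and suppose that a Frobenius complement of $G$ is abelian. If $\alpha,\beta\in\Omega$ with $\alpha\ne\beta$, $\varphi\in G_\alpha$, $\psi\in G_\beta$, and neither $\varphi$ nor $\psi$ is the identity, then $[\varphi,\varphi^\psi]$ is fixed point free on $\Omega$.
   Context: A Frobenius group acting on $\Omega$ is a transitive, non-regular permutation group in which every non-identity element fixes at most one point; the Frobenius kernel consists of the identity and the fixed-point-free elements, and a Frobenius complement is a point stabiliser. Here $\varphi^\psi=\psi^{ -1}\varphi\psi$ and $[g,h]$ denotes the commutator of $g$ and $h$. -}

module Defs where

open import Data.Nat using (ℕ)
open import Data.Fin using (Fin)
open import Data.Fin.Permutation
  using (Permutation′; _⟨$⟩ʳ_; _∘ₚ_; flip; id)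
open import Data.Product using (Σ; _×_; _,_; ∃)
open import Data.Empty using (⊥)
open import Relation.Nullary using (¬_)
open import Relation.Binary.PropositionalEquality using (_≡_; _≢_)
open import Level using (Level; suc; _⊔_)

-- Permutations of Ω = Fin n act on the right: ω^(g h) = (ω^g)^h.
-- In the stdlib, (g ∘ₚ h) applies g first, then h, matching this convention.

_≗ₚ_ : ∀ {n} → Permutation′ n → Permutation′ n → Set
_≗ₚ_ {n} g h = ∀ (ω : Fin n) → g ⟨$⟩ʳ ω ≡ h ⟨$⟩ʳ ω

Fixes : ∀ {n} → Permutation′ n → Fin n → Set
Fixes g ω = g ⟨$⟩ʳ ω ≡ ω

IsIdentity : ∀ {n} → Permutation′ n → Set
IsIdentity g = ∀ ω → Fixes g ω

FixedPointFree : ∀ {n} → Permutation′ n → Set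
FixedPointFree g = ∀ ω → ¬ Fixes g ω

_^_ : ∀ {n} → Permutation′ n → Permutation′ n → Permutation′ n
φ ^ ψ = flip ψ ∘ₚ (φ ∘ₚ ψ)

⟦_,_⟧ : ∀ {n} → Permutation′ n → Permutation′ n → Permutation′ n
⟦ g , h ⟧ = flip g ∘ₚ (flip h ∘ₚ (g ∘ₚ h))

record PermGroup (n : ℕ) (ℓ : Level) : Set (suc ℓ) where
  field
    _∈G : Permutation′ n → Set ℓ
    ∈-resp : ∀ {g h} → g ≗ₚ h → g ∈G → h ∈G
    id-∈  : id ∈G
    ∘-∈   : ∀ {g h} → g ∈G → h ∈G → (g ∘ₚ h) ∈G
    inv-∈ : ∀ {g} → g ∈G → flip g ∈G

open PermGroup public

InStab : ∀ {n ℓ} (G : PermGroup n ℓ) → Fin n → Permutation′ n → Set ℓ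
InStab G α g = (_∈G G g) × Fixes g α

Transitive : ∀ {n ℓ} → PermGroup n ℓ → Set ℓ
Transitive {n} G = ∀ (α β : Fin n) → Σ (Permutation′ n) λ g → _∈G G g × (g ⟨$⟩ʳ α ≡ β)

NonRegular : ∀ {n ℓ} → PermGroup n ℓ → Set ℓ
NonRegular {n} G = Σ (Permutation′ n) λ g → _∈G G g × (¬ IsIdentity g) × ∃ λ α → Fixes g α

AtMostOneFixed : ∀ {n ℓ} → PermGroup n ℓ → Set ℓ
AtMostOneFixed {n} G = ∀ (g : Permutation′ n) → _∈G G g → ¬ IsIdentity g →
  ∀ (α β : Fin n) → Fixes g α → Fixes g β → α ≡ β

IsFrobenius : ∀ {n ℓ} → PermGroup n ℓ → Set ℓ
IsFrobenius G = Transitive G × NonRegular G × AtMostOneFixed G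

-- The Frobenius complement G_α is abelian
StabAbelian : ∀ {n ℓ} → PermGroup n ℓ → Fin n → Set ℓ
StabAbelian G α = ∀ g h → InStab G α g → InStab G α h → (g ∘ₚ h) ≗ₚ (h ∘ₚ g)

{-# OPTIONS --safe #-}
-- Let H = G_γ be the abelian complement and t a transversal with γ^(t x) = x.
-- The transfer V g = ∏ₓ t x · g · (t (x^g))⁻¹ is a homomorphism G → H into an
-- abelian group, so it kills commutators and is invariant under conjugation.
-- On H itself V is the identity: choosing t adapted to the orbits of ⟨h⟩ for
-- h ∈ H, the factor at γ is h, and every other factor is conjugate to an
-- element of H fixing a second point, hence trivial by the Frobenius condition. A commutator fixing a point is
-- conjugate into H and therefore trivial. Finally, if [φ, φ^ψ] = 1 then φ^ψ
-- commutes with φ, so it fixes the unique fixed point α of φ as well as α^ψ ≠ α,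
-- forcing φ^ψ = 1 and φ = 1.
module Submission where

open import Defs
open import Algebra.Bundles using (CommutativeMonoid)
open import Data.Fin using (Fin; toℕ; punchIn)
open import Data.Fin.Permutation
  using (Permutation′; _⟨$⟩ʳ_; _∘ₚ_; flip; id; inverseˡ; inverseʳ)
open import Data.Fin.Properties using (_≟_; toℕ-injective; punchInᵢ≢i; pigeonhole)
open import Data.Nat using (ℕ; zero; suc; _+_; _*_; _≤_; _<?_; z≤n; NonZero)
open import Data.Nat.DivMod using (_%_; _/_; m≡m%n+[m/n]*n; m%n<n)
open import Data.Nat.Properties
  using (≤-refl; ≤-trans; ≤-reflexive; <⇒≤; ≤-antisym; ≮⇒≥; m≤n⇒m<n∨m≡n; m<1+n⇒m≤n;
         +-assoc; +-comm; +-suc; n<1+n; m≤n⇒∃[o]m+o≡n)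
open import Data.Product using (Σ; ∃; _,_; proj₁; proj₂)
open import Data.Sum using (inj₁; inj₂)
open import Function using (_∘_)
open import Level using (Level; 0ℓ)
open import Relation.Nullary using (¬_; yes; no)
open import Relation.Nullary.Decidable using (decidable-stable)
import Relation.Binary.Reasoning.Setoid
open import Relation.Binary.PropositionalEquality
  using (_≡_; _≢_; refl; sym; trans; cong; cong₂; subst; module ≡-Reasoning)

module _ {n : ℕ} where
  open ≡-Reasoning

  ⟨$⟩ʳ-injective : (g : Permutation′ n) {x y : Fin n} → g ⟨$⟩ʳ x ≡ g ⟨$⟩ʳ y → x ≡ y
  ⟨$⟩ʳ-injective g {x} {y} gx≡gy = begin
    x                      ≡⟨ inverseˡ g ⟨
    flip g ⟨$⟩ʳ (g ⟨$⟩ʳ x) ≡⟨ cong (flip g ⟨$⟩ʳ_) gx≡gy ⟩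
    flip g ⟨$⟩ʳ (g ⟨$⟩ʳ y) ≡⟨ inverseˡ g ⟩
    y                      ∎

  flip-inverts : (g : Permutation′ n) {x y : Fin n} → g ⟨$⟩ʳ x ≡ y → flip g ⟨$⟩ʳ y ≡ x
  flip-inverts g gx≡y = trans (cong (flip g ⟨$⟩ʳ_) (sym gx≡y)) (inverseˡ g)

  ^-fixes : (c u : Permutation′ n) {ω : Fin n} → Fixes c ω → Fixes (c ^ u) (u ⟨$⟩ʳ ω)
  ^-fixes c u cω = cong (u ⟨$⟩ʳ_) (trans (cong (c ⟨$⟩ʳ_) (inverseˡ u)) cω)

  ^-identity : (c u : Permutation′ n) → IsIdentity (c ^ u) → IsIdentity c
  ^-identity c u cᵘ≡id x = ⟨$⟩ʳ-injective u (begin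
    u ⟨$⟩ʳ (c ⟨$⟩ʳ x)                       ≡⟨ cong (λ y → u ⟨$⟩ʳ (c ⟨$⟩ʳ y)) (inverseˡ u) ⟨
    u ⟨$⟩ʳ (c ⟨$⟩ʳ (flip u ⟨$⟩ʳ (u ⟨$⟩ʳ x))) ≡⟨ cᵘ≡id (u ⟨$⟩ʳ x) ⟩
    u ⟨$⟩ʳ x                                 ∎)

  commutator-identity⇒commute : (a b : Permutation′ n) → IsIdentity ⟦ a , b ⟧ →
    ∀ x → b ⟨$⟩ʳ (a ⟨$⟩ʳ x) ≡ a ⟨$⟩ʳ (b ⟨$⟩ʳ x)
  commutator-identity⇒commute a b [a,b]≡id x = begin
    b ⟨$⟩ʳ (a ⟨$⟩ʳ x)
      ≡⟨ cong (λ y → b ⟨$⟩ʳ (a ⟨$⟩ʳ y)) (trans (cong (flip b ⟨$⟩ʳ_) (inverseˡ a)) (inverseˡ b)) ⟨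
    ⟦ a , b ⟧ ⟨$⟩ʳ (a ⟨$⟩ʳ (b ⟨$⟩ʳ x))
      ≡⟨ [a,b]≡id _ ⟩
    a ⟨$⟩ʳ (b ⟨$⟩ʳ x) ∎

other-point : ∀ {n} {α β : Fin n} → α ≢ β → (γ : Fin n) → ∃ λ x → x ≢ γ
other-point {α = α} {β} α≢β γ with α ≟ γ
... | yes refl = β , α≢β ∘ sym
... | no α≢γ = α , α≢γ

infix 10 _↑_

_↑_ : ∀ {n} → Permutation′ n → ℕ → Permutation′ n
h ↑ zero = id
h ↑ suc j = h ∘ₚ (h ↑ j)

module _ {n : ℕ} (h : Permutation′ n) where
  open ≡-Reasoning

  ↑-+ : ∀ i j x → h ↑ (i + j) ⟨$⟩ʳ x ≡ h ↑ j ⟨$⟩ʳ (h ↑ i ⟨$⟩ʳ x)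
  ↑-+ zero j x = refl
  ↑-+ (suc i) j x = ↑-+ i j (h ⟨$⟩ʳ x)

  ↑-fixes : ∀ {γ} → Fixes h γ → ∀ j → Fixes (h ↑ j) γ
  ↑-fixes hγ zero = refl
  ↑-fixes hγ (suc j) = trans (cong (h ↑ j ⟨$⟩ʳ_) hγ) (↑-fixes hγ j)

  ↑-mod : ∀ K .{{_ : NonZero K}} → (∀ x → Fixes (h ↑ K) x) →
    ∀ j x → h ↑ j ⟨$⟩ʳ x ≡ h ↑ (j % K) ⟨$⟩ʳ x
  ↑-mod K period j x = begin
    h ↑ j ⟨$⟩ʳ x
      ≡⟨ cong (λ m → h ↑ m ⟨$⟩ʳ x) (trans (m≡m%n+[m/n]*n j K) (+-comm (j % K) _)) ⟩
    h ↑ (j / K * K + j % K) ⟨$⟩ʳ x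
      ≡⟨ multiples (j / K) ⟩
    h ↑ (j % K) ⟨$⟩ʳ x ∎
    where
    multiples : ∀ q {i} → h ↑ (q * K + i) ⟨$⟩ʳ x ≡ h ↑ i ⟨$⟩ʳ x
    multiples zero = refl
    multiples (suc q) {i} = begin
      h ↑ (K + q * K + i) ⟨$⟩ʳ x              ≡⟨ cong (λ m → h ↑ m ⟨$⟩ʳ x) (+-assoc K (q * K) i) ⟩
      h ↑ (K + (q * K + i)) ⟨$⟩ʳ x            ≡⟨ ↑-+ K (q * K + i) x ⟩
      h ↑ (q * K + i) ⟨$⟩ʳ (h ↑ K ⟨$⟩ʳ x)    ≡⟨ cong (h ↑ (q * K + i) ⟨$⟩ʳ_) (period x) ⟩
      h ↑ (q * K + i) ⟨$⟩ʳ x                  ≡⟨ multiples q ⟩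
      h ↑ i ⟨$⟩ʳ x                            ∎

argmin : (ℕ → ℕ) → ℕ → ℕ
argmin f zero = zero
argmin f (suc k) with f (suc k) <? f (argmin f k)
... | yes _ = suc k
... | no _ = argmin f k

argmin-minimal : ∀ (f : ℕ → ℕ) k {j} → j ≤ k → f (argmin f k) ≤ f j
argmin-minimal f zero z≤n = ≤-refl
argmin-minimal f (suc k) j≤1+k with f (suc k) <? f (argmin f k) | m≤n⇒m<n∨m≡n j≤1+k
... | yes fk<min | inj₁ j<1+k = ≤-trans (<⇒≤ fk<min) (argmin-minimal f k (m<1+n⇒m≤n j<1+k))
... | yes _      | inj₂ refl  = ≤-refl
... | no _       | inj₁ j<1+k = argmin-minimal f k (m<1+n⇒m≤n j<1+k)
... | no fk≮min  | inj₂ refl  = ≮⇒≥ fk≮min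

-- rep x is the least point, in the order of Fin n, of the ⟨h⟩-orbit of x.
module Orbit {n} (h : Permutation′ n) (K′ : ℕ) (period : ∀ x → Fixes (h ↑ suc K′) x) where

  step : Fin n → ℕ
  step x = argmin (λ j → toℕ (h ↑ j ⟨$⟩ʳ x)) K′

  rep : Fin n → Fin n
  rep x = h ↑ step x ⟨$⟩ʳ x

  rep-minimal : ∀ x j → toℕ (rep x) ≤ toℕ (h ↑ j ⟨$⟩ʳ x)
  rep-minimal x j =
    ≤-trans (argmin-minimal (λ i → toℕ (h ↑ i ⟨$⟩ʳ x)) K′ (m<1+n⇒m≤n (m%n<n j (suc K′))))
            (≤-reflexive (cong toℕ (sym (↑-mod h (suc K′) period j x))))

  rep-invariant : ∀ x → rep (h ⟨$⟩ʳ x) ≡ rep x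
  rep-invariant x = toℕ-injective (≤-antisym
    (≤-trans (rep-minimal (h ⟨$⟩ʳ x) (K′ + step x)) (≤-reflexive (cong toℕ once-round)))
    (rep-minimal x (suc (step (h ⟨$⟩ʳ x)))))
    where
    once-round : h ↑ (suc K′ + step x) ⟨$⟩ʳ x ≡ rep x
    once-round = trans (↑-+ h (suc K′) (step x) x) (cong (h ↑ step x ⟨$⟩ʳ_) (period x))

module _ {c ℓ} (M : CommutativeMonoid c ℓ) where
  open CommutativeMonoid M
  open import Algebra.Properties.CommutativeMonoid.Sum M
    using (sum; sum-remove; sum-cong-≋; sum-replicate-zero)
  open Relation.Binary.Reasoning.Setoid setoid

  sum-single : ∀ {m} (f : Fin m → Carrier) (i : Fin m) → (∀ j → j ≢ i → f j ≈ ε) → sum f ≈ f i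
  sum-single {suc m} f i vanishes = begin
    sum f                                      ≈⟨ sum-remove {i = i} f ⟩
    f i ∙ sum (λ j → f (punchIn i j))          ≈⟨ ∙-congˡ (sum-cong-≋ (λ j → vanishes _ (punchInᵢ≢i i j))) ⟩
    f i ∙ sum {m} (λ _ → ε)                    ≈⟨ ∙-congˡ (sum-replicate-zero m) ⟩
    f i ∙ ε                                    ≈⟨ identityʳ (f i) ⟩
    f i                                        ∎

module _ {n ℓ} (G : PermGroup n ℓ) where

  ↑-∈ : ∀ {h} → _∈G G h → ∀ j → _∈G G (h ↑ j)
  ↑-∈ h∈ zero = id-∈ G
  ↑-∈ h∈ (suc j) = ∘-∈ G h∈ (↑-∈ h∈ j)

  ^-∈ : ∀ {c u} → _∈G G c → _∈G G u → _∈G G (c ^ u)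
  ^-∈ c∈ u∈ = ∘-∈ G (inv-∈ G u∈) (∘-∈ G c∈ u∈)

  commutator-∈ : ∀ {a b} → _∈G G a → _∈G G b → _∈G G ⟦ a , b ⟧
  commutator-∈ a∈ b∈ = ∘-∈ G (inv-∈ G a∈) (∘-∈ G (inv-∈ G b∈) (∘-∈ G a∈ b∈))

  module _ (one-fixed : AtMostOneFixed G) where

    fixes-two⇒identity : ∀ {g x y} → _∈G G g → x ≢ y → Fixes g x → Fixes g y → IsIdentity g
    fixes-two⇒identity {g} g∈ x≢y gx gy ω = decidable-stable (g ⟨$⟩ʳ ω ≟ ω)
      λ gω≢ω → x≢y (one-fixed g g∈ (λ g≡id → gω≢ω (g≡id ω)) _ _ gx gy)

    commuting-fixes : ∀ {a b α} → _∈G G a → ¬ IsIdentity a → Fixes a α →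
      IsIdentity ⟦ a , b ⟧ → Fixes b α
    commuting-fixes {a} {b} {α} a∈ a≢id aα [a,b]≡id =
      sym (one-fixed a a∈ a≢id α (b ⟨$⟩ʳ α) aα
        (trans (sym (commutator-identity⇒commute a b [a,b]≡id α)) (cong (b ⟨$⟩ʳ_) aα)))

    -- Some point of the ⟨h⟩-orbit of x₀ recurs; the corresponding power of h
    -- fixes it as well as γ, so is the identity.
    finite-order : ∀ {h γ x₀} → _∈G G h → Fixes h γ → x₀ ≢ γ →
      ∃ λ K′ → ∀ x → Fixes (h ↑ suc K′) x
    finite-order {h} {γ} {x₀} h∈ hγ x₀≢γ
      with i , j , i<j , hⁱx₀≡hʲx₀ ← pigeonhole (n<1+n n) (λ i → h ↑ toℕ i ⟨$⟩ʳ x₀)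
      with K′ , i+1+K′≡j ← m≤n⇒∃[o]m+o≡n i<j
      = K′ , fixes-two⇒identity (↑-∈ h∈ (suc K′)) y≢γ recurs (↑-fixes h hγ (suc K′))
      where
      y : Fin n
      y = h ↑ toℕ i ⟨$⟩ʳ x₀
      y≢γ : y ≢ γ
      y≢γ y≡γ = x₀≢γ (⟨$⟩ʳ-injective (h ↑ toℕ i) (trans y≡γ (sym (↑-fixes h hγ (toℕ i)))))
      recurs : Fixes (h ↑ suc K′) y
      recurs = trans (sym (↑-+ h (toℕ i) (suc K′) x₀))
        (trans (cong (λ m → h ↑ m ⟨$⟩ʳ x₀) (trans (+-suc (toℕ i) K′) i+1+K′≡j)) (sym hⁱx₀≡hʲx₀))

-- The transfer into an abelian point stabiliser

module Transfer {n ℓ} (G : PermGroup n ℓ) (γ : Fin n) (abelian : StabAbelian G γ) where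

  Complement : Set ℓ
  Complement = Σ (Permutation′ n) (InStab G γ)

  infix 4 _≈ᶜ_
  infixl 7 _·_

  record _≈ᶜ_ (a b : Complement) : Set where
    constructor pointwise
    field pointwise-≡ : proj₁ a ≗ₚ proj₁ b
  open _≈ᶜ_

  _·_ : Complement → Complement → Complement
  (g , g∈ , gγ) · (h , h∈ , hγ) = g ∘ₚ h , ∘-∈ G g∈ h∈ , trans (cong (h ⟨$⟩ʳ_) gγ) hγ

  one : Complement
  one = id , id-∈ G , refl

  complement-monoid : CommutativeMonoid ℓ 0ℓ
  complement-monoid = record
    { Carrier = Complement ; _≈_ = _≈ᶜ_ ; _∙_ = _·_ ; ε = one
    ; isCommutativeMonoid = record
      { isMonoid = record
        { isSemigroup = record
          { isMagma = record
            { isEquivalence = record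
              { refl = pointwise λ _ → refl
              ; sym = λ a≈b → pointwise λ x → sym (pointwise-≡ a≈b x)
              ; trans = λ a≈b b≈c → pointwise λ x → trans (pointwise-≡ a≈b x) (pointwise-≡ b≈c x) }
            ; ∙-cong = λ {_} {_} {u} a≈b u≈v → pointwise λ x →
                trans (cong (proj₁ u ⟨$⟩ʳ_) (pointwise-≡ a≈b x)) (pointwise-≡ u≈v _) }
          ; assoc = λ _ _ _ → pointwise λ _ → refl }
        ; identity = (λ _ → pointwise λ _ → refl) , (λ _ → pointwise λ _ → refl) }
      ; comm = λ (g , g∈H) (h , h∈H) → pointwise (abelian g h g∈H h∈H) } }

  open CommutativeMonoid complement-monoid
    using (setoid; ∙-cong; ∙-congˡ; identityˡ; identityʳ) renaming (refl to ≈ᶜ-refl; trans to ≈ᶜ-trans)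
  open import Algebra.Properties.CommutativeMonoid.Sum complement-monoid
    using (sum; sum-cong-≋; sum-permute; ∑-distrib-+; sum-replicate-zero)
  open import Algebra.Solver.CommutativeMonoid complement-monoid using (solve; _⊕_; _⊜_)
  module ≈ᶜ-Reasoning = Relation.Binary.Reasoning.Setoid setoid

  module Along (T : Fin n → Permutation′ n) (T∈ : ∀ x → _∈G G (T x))
               (Tγ : ∀ x → T x ⟨$⟩ʳ γ ≡ x) where

    factor : (g : Permutation′ n) → _∈G G g → Fin n → Complement
    factor g g∈ x = T x ∘ₚ (g ∘ₚ flip (T (g ⟨$⟩ʳ x))) ,
      ∘-∈ G (T∈ x) (∘-∈ G g∈ (inv-∈ G (T∈ _))) ,
      flip-inverts (T (g ⟨$⟩ʳ x)) (trans (Tγ (g ⟨$⟩ʳ x)) (cong (g ⟨$⟩ʳ_) (sym (Tγ x))))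

    transfer : (g : Permutation′ n) → _∈G G g → Complement
    transfer g g∈ = sum (factor g g∈)

    transfer-cong : ∀ {g g′} (g∈ : _∈G G g) (g′∈ : _∈G G g′) → g ≗ₚ g′ →
      transfer g g∈ ≈ᶜ transfer g′ g′∈
    transfer-cong g∈ g′∈ g≗g′ = sum-cong-≋ λ x → pointwise λ y →
      cong₂ (λ z w → flip (T z) ⟨$⟩ʳ w) (g≗g′ x) (g≗g′ _)

    transfer-∘ : ∀ {g k} (g∈ : _∈G G g) (k∈ : _∈G G k) →
      transfer (g ∘ₚ k) (∘-∈ G g∈ k∈) ≈ᶜ transfer g g∈ · transfer k k∈
    transfer-∘ {g} {k} g∈ k∈ = begin
      transfer (g ∘ₚ k) (∘-∈ G g∈ k∈)
        ≈⟨ sum-cong-≋ (λ x → pointwise λ y →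
             cong (λ z → flip (T (k ⟨$⟩ʳ (g ⟨$⟩ʳ x))) ⟨$⟩ʳ (k ⟨$⟩ʳ z)) (sym (inverseʳ (T (g ⟨$⟩ʳ x))))) ⟩
      sum (λ x → factor g g∈ x · factor k k∈ (g ⟨$⟩ʳ x))
        ≈⟨ ∑-distrib-+ (factor g g∈) (λ x → factor k k∈ (g ⟨$⟩ʳ x)) ⟩
      transfer g g∈ · sum (λ x → factor k k∈ (g ⟨$⟩ʳ x))
        ≈⟨ ∙-congˡ (sum-permute (factor k k∈) g) ⟨
      transfer g g∈ · transfer k k∈ ∎
      where open ≈ᶜ-Reasoning

    transfer-id : transfer id (id-∈ G) ≈ᶜ one
    transfer-id = begin
      transfer id (id-∈ G) ≈⟨ sum-cong-≋ (λ x → pointwise λ y → inverseˡ (T x)) ⟩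
      sum {n} (λ _ → one)  ≈⟨ sum-replicate-zero n ⟩
      one                  ∎
      where open ≈ᶜ-Reasoning

    transfer-flip : ∀ {g} (g∈ : _∈G G g) → transfer (flip g) (inv-∈ G g∈) · transfer g g∈ ≈ᶜ one
    transfer-flip {g} g∈ = begin
      transfer (flip g) (inv-∈ G g∈) · transfer g g∈ ≈⟨ transfer-∘ (inv-∈ G g∈) g∈ ⟨
      transfer (flip g ∘ₚ g) _                       ≈⟨ transfer-cong _ (id-∈ G) (λ _ → inverseʳ g) ⟩
      transfer id (id-∈ G)                           ≈⟨ transfer-id ⟩
      one                                            ∎
      where open ≈ᶜ-Reasoning

    transfer-commutator : ∀ {a b} (a∈ : _∈G G a) (b∈ : _∈G G b) →
      transfer ⟦ a , b ⟧ (commutator-∈ G a∈ b∈) ≈ᶜ one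
    transfer-commutator {a} {b} a∈ b∈ = begin
      transfer ⟦ a , b ⟧ (commutator-∈ G a∈ b∈)
        ≈⟨ transfer-∘ a⁻¹∈ _ ⟩
      A⁻¹ · transfer (flip b ∘ₚ (a ∘ₚ b)) _
        ≈⟨ ∙-congˡ (transfer-∘ b⁻¹∈ _) ⟩
      A⁻¹ · (B⁻¹ · transfer (a ∘ₚ b) _)
        ≈⟨ ∙-congˡ {A⁻¹} (∙-congˡ {B⁻¹} (transfer-∘ a∈ b∈)) ⟩
      A⁻¹ · (B⁻¹ · (A · B))
        ≈⟨ solve 4 (λ p q r s → p ⊕ (q ⊕ (r ⊕ s)) ⊜ (p ⊕ r) ⊕ (q ⊕ s)) ≈ᶜ-refl A⁻¹ B⁻¹ A B ⟩
      (A⁻¹ · A) · (B⁻¹ · B)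
        ≈⟨ ∙-cong (transfer-flip a∈) (transfer-flip b∈) ⟩
      one · one
        ≈⟨ identityˡ one ⟩
      one ∎
      where
      open ≈ᶜ-Reasoning
      a⁻¹∈ : _∈G G (flip a)
      a⁻¹∈ = inv-∈ G a∈
      b⁻¹∈ : _∈G G (flip b)
      b⁻¹∈ = inv-∈ G b∈
      A B A⁻¹ B⁻¹ : Complement
      A = transfer a a∈
      B = transfer b b∈
      A⁻¹ = transfer (flip a) a⁻¹∈
      B⁻¹ = transfer (flip b) b⁻¹∈

    transfer-^ : ∀ {c u} (c∈ : _∈G G c) (u∈ : _∈G G u) →
      transfer (c ^ u) (^-∈ G c∈ u∈) ≈ᶜ transfer c c∈
    transfer-^ {c} {u} c∈ u∈ = begin
      transfer (c ^ u) (^-∈ G c∈ u∈)   ≈⟨ transfer-∘ u⁻¹∈ _ ⟩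
      U⁻¹ · transfer (c ∘ₚ u) _        ≈⟨ ∙-congˡ (transfer-∘ c∈ u∈) ⟩
      U⁻¹ · (C · U)                    ≈⟨ solve 3 (λ p q r → p ⊕ (q ⊕ r) ⊜ q ⊕ (p ⊕ r)) ≈ᶜ-refl U⁻¹ C U ⟩
      C · (U⁻¹ · U)                    ≈⟨ ∙-congˡ (transfer-flip u∈) ⟩
      C · one                          ≈⟨ identityʳ C ⟩
      C                                ∎
      where
      open ≈ᶜ-Reasoning
      u⁻¹∈ : _∈G G (flip u)
      u⁻¹∈ = inv-∈ G u∈
      U U⁻¹ C : Complement
      U = transfer u u∈
      U⁻¹ = transfer (flip u) u⁻¹∈
      C = transfer c c∈

  module Adapted (transitive : Transitive G) (one-fixed : AtMostOneFixed G)
      {h : Permutation′ n} (h∈ : _∈G G h) (hγ : Fixes h γ)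
      (K′ : ℕ) (period : ∀ x → Fixes (h ↑ suc K′) x) where
    open Orbit h K′ period

    t : Fin n → Permutation′ n
    t x = proj₁ (transitive γ x)

    U : Fin n → Permutation′ n
    U x = t (rep x) ∘ₚ flip (h ↑ step x)

    U∈ : ∀ x → _∈G G (U x)
    U∈ x = ∘-∈ G (proj₁ (proj₂ (transitive γ (rep x)))) (inv-∈ G (↑-∈ G h∈ (step x)))

    Uγ : ∀ x → U x ⟨$⟩ʳ γ ≡ x
    Uγ x = flip-inverts (h ↑ step x) (sym (proj₂ (proj₂ (transitive γ (rep x)))))

    open Along U U∈ Uγ

    factor-at-γ : factor h h∈ γ ≈ᶜ (h , h∈ , hγ)
    factor-at-γ = pointwise λ y → begin
      flip (U (h ⟨$⟩ʳ γ)) ⟨$⟩ʳ (h ⟨$⟩ʳ (U γ ⟨$⟩ʳ y))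
        ≡⟨ cong (λ z → flip (U z) ⟨$⟩ʳ (h ⟨$⟩ʳ (U γ ⟨$⟩ʳ y))) hγ ⟩
      flip (U γ) ⟨$⟩ʳ (h ⟨$⟩ʳ (U γ ⟨$⟩ʳ y))
        ≡⟨ cong (flip (U γ) ⟨$⟩ʳ_) (abelian (U γ) h (U∈ γ , Uγ γ) (h∈ , hγ) y) ⟩
      flip (U γ) ⟨$⟩ʳ (U γ ⟨$⟩ʳ (h ⟨$⟩ʳ y))
        ≡⟨ inverseˡ (U γ) ⟩
      h ⟨$⟩ʳ y ∎
      where open ≡-Reasoning

    -- Away from γ, the part of the factor between the two transversal elements
    -- fixes both γ and rep x.
    factor-away-from-γ : ∀ x → x ≢ γ → factor h h∈ x ≈ᶜ one
    factor-away-from-γ x x≢γ = pointwise λ y → begin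
      flip (t (rep (h ⟨$⟩ʳ x))) ⟨$⟩ʳ (middle ⟨$⟩ʳ (t (rep x) ⟨$⟩ʳ y))
        ≡⟨ cong (flip (t (rep (h ⟨$⟩ʳ x))) ⟨$⟩ʳ_) (middle≡id _) ⟩
      flip (t (rep (h ⟨$⟩ʳ x))) ⟨$⟩ʳ (t (rep x) ⟨$⟩ʳ y)
        ≡⟨ cong (λ z → flip (t z) ⟨$⟩ʳ (t (rep x) ⟨$⟩ʳ y)) (rep-invariant x) ⟩
      flip (t (rep x)) ⟨$⟩ʳ (t (rep x) ⟨$⟩ʳ y)
        ≡⟨ inverseˡ (t (rep x)) ⟩
      y ∎
      where
      open ≡-Reasoning
      s s′ : ℕ
      s = step x
      s′ = step (h ⟨$⟩ʳ x)
      middle : Permutation′ n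
      middle = flip (h ↑ s) ∘ₚ (h ∘ₚ h ↑ s′)
      middle-γ : Fixes middle γ
      middle-γ = trans (cong (λ z → h ↑ s′ ⟨$⟩ʳ (h ⟨$⟩ʳ z)) (flip-inverts (h ↑ s) (↑-fixes h hγ s)))
                       (trans (cong (h ↑ s′ ⟨$⟩ʳ_) hγ) (↑-fixes h hγ s′))
      middle-rep : Fixes middle (rep x)
      middle-rep = trans (cong (λ z → h ↑ s′ ⟨$⟩ʳ (h ⟨$⟩ʳ z)) (inverseˡ (h ↑ s))) (rep-invariant x)
      rep≢γ : rep x ≢ γ
      rep≢γ rep≡γ = x≢γ (⟨$⟩ʳ-injective (h ↑ s) (trans rep≡γ (sym (↑-fixes h hγ s))))
      middle≡id : IsIdentity middle
      middle≡id = fixes-two⇒identity G one-fixed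
        (∘-∈ G (inv-∈ G (↑-∈ G h∈ s)) (∘-∈ G h∈ (↑-∈ G h∈ s′))) rep≢γ middle-rep middle-γ

    transfer-complement : transfer h h∈ ≈ᶜ (h , h∈ , hγ)
    transfer-complement =
      ≈ᶜ-trans (sum-single complement-monoid (factor h h∈) γ factor-away-from-γ) factor-at-γ

  commutator-fixing-point⇒identity : Transitive G → AtMostOneFixed G → ∀ {x₀} → x₀ ≢ γ →
    ∀ {a b ω} → _∈G G a → _∈G G b → Fixes ⟦ a , b ⟧ ω → IsIdentity ⟦ a , b ⟧
  commutator-fixing-point⇒identity transitive one-fixed x₀≢γ {a} {b} {ω} a∈ b∈ cω =
    ^-identity c u (pointwise-≡ cᵘ≈one)
    where
    c u : Permutation′ n
    c = ⟦ a , b ⟧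
    u = flip (proj₁ (transitive γ ω))
    c∈ : _∈G G c
    c∈ = commutator-∈ G a∈ b∈
    u∈ : _∈G G u
    u∈ = inv-∈ G (proj₁ (proj₂ (transitive γ ω)))
    cᵘ∈ : _∈G G (c ^ u)
    cᵘ∈ = ^-∈ G c∈ u∈
    cᵘγ : Fixes (c ^ u) γ
    cᵘγ = subst (Fixes (c ^ u))
      (flip-inverts (proj₁ (transitive γ ω)) (proj₂ (proj₂ (transitive γ ω)))) (^-fixes c u cω)
    order : ∃ λ K′ → ∀ x → Fixes ((c ^ u) ↑ suc K′) x
    order = finite-order G one-fixed cᵘ∈ cᵘγ x₀≢γ
    open Adapted transitive one-fixed cᵘ∈ cᵘγ (proj₁ order) (proj₂ order)
    open Along U U∈ Uγ
    open ≈ᶜ-Reasoning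
    cᵘ≈one : (c ^ u , cᵘ∈ , cᵘγ) ≈ᶜ one
    cᵘ≈one = begin
      (c ^ u , cᵘ∈ , cᵘγ) ≈⟨ transfer-complement ⟨
      transfer (c ^ u) cᵘ∈ ≈⟨ transfer-^ c∈ u∈ ⟩
      transfer c c∈        ≈⟨ transfer-commutator a∈ b∈ ⟩
      one                  ∎

lemma3p2 : ∀ {ℓ : Level} (n : ℕ) (G : PermGroup n ℓ) →
    IsFrobenius G →
    (∃ λ (γ : Fin n) → StabAbelian G γ) →
    (α β : Fin n) → α ≢ β →
    (φ ψ : Permutation′ n) →
    InStab G α φ → InStab G β ψ →
    ¬ IsIdentity φ → ¬ IsIdentity ψ →
    FixedPointFree ⟦ φ , φ ^ ψ ⟧
lemma3p2 n G (transitive , _ , one-fixed) (γ , abelian) α β α≢β φ ψ (φ∈ , φα) (ψ∈ , ψβ) φ≢id ψ≢id ω fixes =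
  φ≢id (^-identity φ ψ φᵠ≡id)
  where
  open Transfer G γ abelian using (commutator-fixing-point⇒identity)
  φᵠ∈ : _∈G G (φ ^ ψ)
  φᵠ∈ = ^-∈ G φ∈ ψ∈
  commute : IsIdentity ⟦ φ , φ ^ ψ ⟧
  commute = commutator-fixing-point⇒identity transitive one-fixed (proj₂ (other-point α≢β γ))
    φ∈ φᵠ∈ fixes
  α≢αᵠ : α ≢ ψ ⟨$⟩ʳ α
  α≢αᵠ α≡αᵠ = α≢β (sym (one-fixed ψ ψ∈ ψ≢id β α ψβ (sym α≡αᵠ)))
  φᵠ≡id : IsIdentity (φ ^ ψ)
  φᵠ≡id = fixes-two⇒identity G one-fixed φᵠ∈ α≢αᵠ
    (commuting-fixes G one-fixed {b = φ ^ ψ} φ∈ φ≢id φα commute) (^-fixes φ ψ φα)
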